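{- Let $U$ be a multiset of elements of $\mathbb Z/5\mathbb Z\setminus\{0\}$ of total size $u\ge 4$. Then for every integer $\ell$ with $0\le\ell\le u-4$, $\Sigma_\ell(U)\cup\Sigma_{\ell+1}(U)\cup\Sigma_{\ell+2}(U)\cup\Sigma_{\ell+3}(U)\cup\Sigma_{\ell+4}(U)=\mathbb Z/5\mathbb Z$.
   Context: For a multiset $U$ in an abelian group $G$, $v_\alpha(U)$ denotes the multiplicity of $\alpha$ in $U$, and for an integer $\ell\ge 0$, $\Sigma_\ell(U)=\{\sum_{\alpha\in G}c_\alpha\alpha:\ c_\alpha\in\mathbb Z,\ 0\le c_\alpha\le v_\alpha(U),\ \sum_\alpha c_\alpha=\ell\}$. -}

module Defs where

open import Data.Nat using (ℕ; _+_; _*_; _≤_; _%_)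
open import Data.Fin using (Fin; toℕ)
open import Data.Fin.Patterns using (0F; 1F; 2F; 3F; 4F)
open import Data.Product using (Σ; _×_)
open import Relation.Binary.PropositionalEquality using (_≡_)

ZMod5 : Set
ZMod5 = Fin 5

-- A multiset U in Z/5Z is given by its multiplicity function v_α(U).
Multiset : Set
Multiset = ZMod5 → ℕ

sum5 : (ZMod5 → ℕ) → ℕ
sum5 f = f 0F + f 1F + f 2F + f 3F + f 4F

size : Multiset → ℕ
size v = sum5 v

AvoidsZero : Multiset → Set
AvoidsZero v = v 0F ≡ 0

-- x ∈ Σ_ℓ(U): there are integers 0 ≤ c_α ≤ v_α(U) with Σ c_α = ℓ and
-- Σ c_α α = x in Z/5Z (the group sum computed as a natural number mod 5).
InSigma : Multiset → ℕ → ZMod5 → Set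
InSigma v ℓ x =
  Σ (ZMod5 → ℕ) λ c →
    ((α : ZMod5) → c α ≤ v α)
    × (sum5 c ≡ ℓ)
    × ((sum5 (λ α → c α * toℕ α)) % 5 ≡ toℕ x)

-- Take any ℓ elements of U. What is left still contains at least four nonzero
-- residues, and (a finite check) the sub-multiset sums of any four nonzero
-- residues mod 5 already cover Z/5Z. So every target is reached by the ℓ chosen
-- elements plus between 0 and 4 further ones.
module Submission where

open import Defs
open import Data.Nat using (ℕ; suc; NonZero; _+_; _*_; _∸_; _≤_; _%_; _≤?_; z≤n; s≤s)
open import Data.Nat.Properties
open import Data.Nat.DivMod using (%-distribˡ-+; m%n%n≡m%n; [m+kn]%n≡m%n; m<n⇒m%n≡m; m%n<n)
open import Data.Nat.Tactic.RingSolver using (solve-∀)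
open import Data.Fin using (Fin; toℕ; fromℕ<)
open import Data.Fin.Patterns using (0F; 1F; 2F; 3F; 4F)
open import Data.Fin.Properties using (all?; any?; toℕ<n; toℕ-fromℕ<)
open import Data.Product using (∃; ∃₂; _×_; _,_)
open import Function using (case_of_)
open import Data.Sum using (_⊎_; inj₁; inj₂)
open import Relation.Nullary using (Dec; yes; no)
open import Relation.Nullary.Decidable using (_×-dec_; _→-dec_; toWitness)
open import Relation.Binary.PropositionalEquality

_⊑_ : Multiset → Multiset → Set
c ⊑ v = ∀ α → c α ≤ v α

_∖_ : Multiset → Multiset → Multiset
(v ∖ b) α = v α ∸ b α

_⊕_ : Multiset → Multiset → Multiset
(b ⊕ c) α = b α + c α

weight : Multiset → ℕ
weight c = sum5 (λ α → c α * toℕ α)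

sum5-cong : ∀ {f g : ZMod5 → ℕ} → (∀ α → f α ≡ g α) → sum5 f ≡ sum5 g
sum5-cong f≗g rewrite f≗g 0F | f≗g 1F | f≗g 2F | f≗g 3F | f≗g 4F = refl

sum5-mono-≤ : ∀ {f g : ZMod5 → ℕ} → f ⊑ g → sum5 f ≤ sum5 g
sum5-mono-≤ f⊑g =
  +-mono-≤ (+-mono-≤ (+-mono-≤ (+-mono-≤ (f⊑g 0F) (f⊑g 1F)) (f⊑g 2F)) (f⊑g 3F)) (f⊑g 4F)

sum5-+ : ∀ (f g : ZMod5 → ℕ) → sum5 (λ α → f α + g α) ≡ sum5 f + sum5 g
sum5-+ f g = interchange (f 0F) (f 1F) (f 2F) (f 3F) (f 4F) (g 0F) (g 1F) (g 2F) (g 3F) (g 4F)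
  where
  interchange : ∀ a b c d e a′ b′ c′ d′ e′ →
    (a + a′) + (b + b′) + (c + c′) + (d + d′) + (e + e′)
      ≡ (a + b + c + d + e) + (a′ + b′ + c′ + d′ + e′)
  interchange = solve-∀

weight-⊕ : ∀ (b c : Multiset) → weight (b ⊕ c) ≡ weight b + weight c
weight-⊕ b c = trans (sum5-cong (λ α → *-distribʳ-+ (toℕ α) (b α) (c α)))
                     (sum5-+ (λ α → b α * toℕ α) (λ α → c α * toℕ α))

multiplicity≤size : ∀ (v : Multiset) α → v α ≤ size v
multiplicity≤size v 0F =
  ≤-trans (m≤m+n _ (v 1F)) (≤-trans (m≤m+n _ (v 2F)) (≤-trans (m≤m+n _ (v 3F)) (m≤m+n _ (v 4F))))
multiplicity≤size v 1F =
  ≤-trans (m≤n+m _ (v 0F)) (≤-trans (m≤m+n _ (v 2F)) (≤-trans (m≤m+n _ (v 3F)) (m≤m+n _ (v 4F))))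
multiplicity≤size v 2F =
  ≤-trans (m≤n+m _ (v 0F + v 1F)) (≤-trans (m≤m+n _ (v 3F)) (m≤m+n _ (v 4F)))
multiplicity≤size v 3F = ≤-trans (m≤n+m _ (v 0F + v 1F + v 2F)) (m≤m+n _ (v 4F))
multiplicity≤size v 4F = m≤n+m _ (v 0F + v 1F + v 2F + v 3F)

size-∖ : ∀ {b v : Multiset} → b ⊑ v → size v ≡ size b + size (v ∖ b)
size-∖ {b} {v} b⊑v = trans (sym (sum5-cong (λ α → m+[n∸m]≡n (b⊑v α)))) (sum5-+ b (v ∖ b))

≤-+-split : ∀ {k} m n → k ≤ m + n → ∃₂ λ i j → i ≤ m × j ≤ n × i + j ≡ k
≤-+-split {k} m n k≤m+n with k ≤? m
... | yes k≤m = k , 0 , k≤m , z≤n , +-identityʳ k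
... | no k≰m  = m , k ∸ m , ≤-refl , ≤-trans (∸-monoˡ-≤ m k≤m+n) (≤-reflexive (m+n∸m≡n m n)) ,
                m+[n∸m]≡n (<⇒≤ (≰⇒> k≰m))

submultiset-of-size : ∀ (v : Multiset) {k} → k ≤ size v → ∃ λ b → b ⊑ v × size b ≡ k
submultiset-of-size v k≤ with ≤-+-split (v 0F + v 1F + v 2F + v 3F) (v 4F) k≤
... | k₃ , b₄ , k₃≤ , b₄≤ , refl with ≤-+-split (v 0F + v 1F + v 2F) (v 3F) k₃≤
... | k₂ , b₃ , k₂≤ , b₃≤ , refl with ≤-+-split (v 0F + v 1F) (v 2F) k₂≤
... | k₁ , b₂ , k₁≤ , b₂≤ , refl with ≤-+-split (v 0F) (v 1F) k₁≤
... | b₀ , b₁ , b₀≤ , b₁≤ , refl = b , b⊑v , refl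
  where
  b : Multiset
  b 0F = b₀
  b 1F = b₁
  b 2F = b₂
  b 3F = b₃
  b 4F = b₄
  b⊑v : b ⊑ v
  b⊑v 0F = b₀≤
  b⊑v 1F = b₁≤
  b⊑v 2F = b₂≤
  b⊑v 3F = b₃≤
  b⊑v 4F = b₄≤

nonzeroMultiset : (p q r s : Fin 5) → Multiset
nonzeroMultiset p q r s 0F = 0
nonzeroMultiset p q r s 1F = toℕ p
nonzeroMultiset p q r s 2F = toℕ q
nonzeroMultiset p q r s 3F = toℕ r
nonzeroMultiset p q r s 4F = toℕ s

SubmultisetSum : (p q r s y : Fin 5) → Set
SubmultisetSum p q r s y = ∃ λ a → ∃ λ b → ∃ λ c → ∃ λ d →
  (toℕ a ≤ toℕ p × toℕ b ≤ toℕ q × toℕ c ≤ toℕ r × toℕ d ≤ toℕ s)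
  × weight (nonzeroMultiset a b c d) % 5 ≡ toℕ y

submultisetSum? : ∀ p q r s y → Dec (SubmultisetSum p q r s y)
submultisetSum? p q r s y = any? λ a → any? λ b → any? λ c → any? λ d →
  ((toℕ a ≤? toℕ p) ×-dec (toℕ b ≤? toℕ q) ×-dec (toℕ c ≤? toℕ r) ×-dec (toℕ d ≤? toℕ s))
  ×-dec (weight (nonzeroMultiset a b c d) % 5 ≟ toℕ y)

-- Opaque, so that Agda never unfolds the (large) proof term produced by the search.
opaque
  nonzeroMultiset-sums-cover : ∀ p q r s → toℕ p + toℕ q + toℕ r + toℕ s ≡ 4 →
    ∀ y → SubmultisetSum p q r s y
  nonzeroMultiset-sums-cover = toWitness {a? = all? λ p → all? λ q → all? λ r → all? λ s →
    (toℕ p + toℕ q + toℕ r + toℕ s ≟ 4) →-dec all? λ y → submultisetSum? p q r s y} _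

nonzeroMultiset-mono : ∀ {a b c d p q r s} →
  toℕ a ≤ toℕ p × toℕ b ≤ toℕ q × toℕ c ≤ toℕ r × toℕ d ≤ toℕ s →
  nonzeroMultiset a b c d ⊑ nonzeroMultiset p q r s
nonzeroMultiset-mono _                   0F = z≤n
nonzeroMultiset-mono (a≤ , _ , _ , _)   1F = a≤
nonzeroMultiset-mono (_ , b≤ , _ , _)   2F = b≤
nonzeroMultiset-mono (_ , _ , c≤ , _)   3F = c≤
nonzeroMultiset-mono (_ , _ , _ , d≤)   4F = d≤

nonzeroMultiset-of-size4 : (w : Multiset) → AvoidsZero w → size w ≡ 4 →
  ∃ λ p → ∃ λ q → ∃ λ r → ∃ λ s → ∀ α → nonzeroMultiset p q r s α ≡ w α
nonzeroMultiset-of-size4 w w0≡0 size≡4 = fin 1F , fin 2F , fin 3F , fin 4F , λ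
  { 0F → sym w0≡0 ; 1F → toℕ-fromℕ< _ ; 2F → toℕ-fromℕ< _ ; 3F → toℕ-fromℕ< _ ; 4F → toℕ-fromℕ< _ }
  where
  fin : ZMod5 → Fin 5
  fin α = fromℕ< (s≤s (≤-trans (multiplicity≤size w α) (≤-reflexive size≡4)))

avoidsZero-size4-sums-cover : (w : Multiset) → AvoidsZero w → size w ≡ 4 →
  ∀ y → ∃ λ c → c ⊑ w × weight c % 5 ≡ toℕ y
avoidsZero-size4-sums-cover w w0≡0 size≡4 y with nonzeroMultiset-of-size4 w w0≡0 size≡4
... | p , q , r , s , ≗w with nonzeroMultiset-sums-cover p q r s (trans (sum5-cong ≗w) size≡4) y
... | a , b , c , d , bounds , sum≡y =
  nonzeroMultiset a b c d , (λ α → ≤-trans (nonzeroMultiset-mono bounds α) (≤-reflexive (≗w α))) , sum≡y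

avoidsZero-sums≤4-cover : (d : Multiset) → AvoidsZero d → 4 ≤ size d →
  ∀ y → ∃ λ c → c ⊑ d × size c ≤ 4 × weight c % 5 ≡ toℕ y
avoidsZero-sums≤4-cover d d0≡0 4≤size y with submultiset-of-size d 4≤size
... | w , w⊑d , size≡4 with avoidsZero-size4-sums-cover w (n≤0⇒n≡0 (subst (w 0F ≤_) d0≡0 (w⊑d 0F))) size≡4 y
... | c , c⊑w , sum≡y =
  c , (λ α → ≤-trans (c⊑w α) (w⊑d α)) , ≤-trans (sum5-mono-≤ c⊑w) (≤-reflexive size≡4) , sum≡y

[m+n%d]%d≡[m+n]%d : ∀ m n d .{{_ : NonZero d}} → (m + n % d) % d ≡ (m + n) % d
[m+n%d]%d≡[m+n]%d m n d = begin
  (m + n % d) % d           ≡⟨ %-distribˡ-+ m (n % d) d ⟩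
  (m % d + n % d % d) % d   ≡⟨ cong (λ k → (m % d + k) % d) (m%n%n≡m%n n d) ⟩
  (m % d + n % d) % d       ≡⟨ %-distribˡ-+ m n d ⟨
  (m + n) % d               ∎
  where open ≡-Reasoning

-- y is x − n in Z/5Z, computed as x + 4n to avoid truncated subtraction.
difference : ∀ n (x : ZMod5) → ∃ λ y → (n + toℕ y) % 5 ≡ toℕ x
difference n x = y , (begin
  (n + toℕ y) % 5                  ≡⟨ cong (λ k → (n + k) % 5) (toℕ-fromℕ< _) ⟩
  (n + (toℕ x + 4 * n) % 5) % 5    ≡⟨ [m+n%d]%d≡[m+n]%d n (toℕ x + 4 * n) 5 ⟩
  (n + (toℕ x + 4 * n)) % 5        ≡⟨ cong (_% 5) (rearrange (toℕ x) n) ⟩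
  (toℕ x + n * 5) % 5              ≡⟨ [m+kn]%n≡m%n (toℕ x) n 5 ⟩
  toℕ x % 5                        ≡⟨ m<n⇒m%n≡m (toℕ<n x) ⟩
  toℕ x                            ∎)
  where
  open ≡-Reasoning
  y : ZMod5
  y = fromℕ< (m%n<n (toℕ x + 4 * n) 5)
  rearrange : ∀ x n → n + (x + 4 * n) ≡ x + n * 5
  rearrange = solve-∀

InSigma-extend : ∀ {v b c : Multiset} {x} → b ⊑ v → c ⊑ (v ∖ b) →
  (weight b + weight c % 5) % 5 ≡ toℕ x → InSigma v (size b + size c) x
InSigma-extend {v} {b} {c} {x} b⊑v c⊑v∖b sum≡x =
  b ⊕ c ,
  (λ α → ≤-trans (+-monoʳ-≤ (b α) (c⊑v∖b α)) (≤-reflexive (m+[n∸m]≡n (b⊑v α)))) ,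
  sum5-+ b c ,
  (begin
    weight (b ⊕ c) % 5              ≡⟨ cong (_% 5) (weight-⊕ b c) ⟩
    (weight b + weight c) % 5       ≡⟨ [m+n%d]%d≡[m+n]%d (weight b) (weight c) 5 ⟨
    (weight b + weight c % 5) % 5   ≡⟨ sum≡x ⟩
    toℕ x                           ∎)
  where open ≡-Reasoning

window : ∀ {P : ℕ → Set} ℓ {j} → j ≤ 4 → P (ℓ + j) →
  P ℓ ⊎ P (ℓ + 1) ⊎ P (ℓ + 2) ⊎ P (ℓ + 3) ⊎ P (ℓ + 4)
window {P} ℓ {0} _ p = inj₁ (subst P (+-identityʳ ℓ) p)
window ℓ {1} _ p = inj₂ (inj₁ p)
window ℓ {2} _ p = inj₂ (inj₂ (inj₁ p))
window ℓ {3} _ p = inj₂ (inj₂ (inj₂ (inj₁ p)))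
window ℓ {4} _ p = inj₂ (inj₂ (inj₂ (inj₂ p)))
window ℓ {suc (suc (suc (suc (suc _))))} (s≤s (s≤s (s≤s (s≤s ())))) _

lemma3p7 : (v : Multiset) → AvoidsZero v → 4 ≤ size v →
    (ℓ : ℕ) → ℓ ≤ size v ∸ 4 → (x : ZMod5) →
      InSigma v ℓ x ⊎ InSigma v (ℓ + 1) x ⊎ InSigma v (ℓ + 2) x
        ⊎ InSigma v (ℓ + 3) x ⊎ InSigma v (ℓ + 4) x
lemma3p7 v v0≡0 4≤size ℓ ℓ≤size∸4 x
  with submultiset-of-size v (≤-trans ℓ≤size∸4 (m∸n≤m (size v) 4))
... | b , b⊑v , refl with difference (weight b) x
... | y , b+y≡x = case avoidsZero-sums≤4-cover (v ∖ b) v∖b-avoidsZero 4≤size-v∖b y of λ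
  { (c , c⊑v∖b , size≤4 , c≡y) → window {P = λ k → InSigma v k x} (size b) size≤4
      (InSigma-extend b⊑v c⊑v∖b (trans (cong (λ k → (weight b + k) % 5) c≡y) b+y≡x)) }
  where
  v∖b-avoidsZero : AvoidsZero (v ∖ b)
  v∖b-avoidsZero = trans (cong (_∸ b 0F) v0≡0) (0∸n≡0 (b 0F))
  4≤size-v∖b : 4 ≤ size (v ∖ b)
  4≤size-v∖b = +-cancelˡ-≤ (size b) 4 (size (v ∖ b)) (begin
    size b + 4              ≤⟨ +-monoˡ-≤ 4 ℓ≤size∸4 ⟩
    size v ∸ 4 + 4          ≡⟨ m∸n+n≡m 4≤size ⟩
    size v                  ≡⟨ size-∖ b⊑v ⟩
    size b + size (v ∖ b)   ∎)
    where open ≤-Reasoning
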